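{- For the path $P_n$ on $n \ge 2$ vertices, $\textrm{RED:LD}(P_n) = \lceil (2n+2)/3 \rceil$.
   Context: $N(v)$ denotes the open neighborhood of $v$. A set $S \subseteq V(G)$ is a locating-dominating (LD) set if for all $u,v \in V(G)-S$: $N(v)\cap S \neq \varnothing$, and if $u \ne v$ then $N(v) \cap S \neq N(u) \cap S$. A RED:LD set is an LD set $S$ such that $S-\{v\}$ is an LD set for every $v \in S$. $\textrm{RED:LD}(G)$ is the minimum cardinality of a RED:LD set of $G$. -}

module Defs where

open import Data.Nat using (ℕ; suc; _+_; _≤_)
open import Data.Fin using (Fin; toℕ)
open import Data.Fin.Subset using (Subset; _∈_; _∉_; _-_; ∣_∣)
open import Data.Product using (_×_; Σ-syntax)
open import Data.Sum using (_⊎_)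
open import Relation.Binary.PropositionalEquality using (_≡_)
open import Relation.Nullary using (¬_)
open import Function.Bundles using (_⇔_)

record Graph (n : ℕ) : Set₁ where
  field
    Adj : Fin n → Fin n → Set

open Graph public

Path : (n : ℕ) → Graph n
Adj (Path n) i j = (suc (toℕ i) ≡ toℕ j) ⊎ (suc (toℕ j) ≡ toℕ i)

module _ {n : ℕ} (G : Graph n) where

  InNbhdS : Subset n → Fin n → Fin n → Set
  InNbhdS S v w = (w ∈ S) × Adj G v w

  IsLD : Subset n → Set
  IsLD S =
    (∀ v → v ∉ S → Σ[ w ∈ Fin n ] InNbhdS S v w)
    × (∀ u v → u ∉ S → v ∉ S → ¬ (u ≡ v) →
         ¬ (∀ w → InNbhdS S v w ⇔ InNbhdS S u w))

  IsREDLD : Subset n → Set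
  IsREDLD S = IsLD S × (∀ v → v ∈ S → IsLD (S - v))

  REDLDNumber : ℕ → Set
  REDLDNumber k =
    (Σ[ S ∈ Subset n ] (IsREDLD S × ∣ S ∣ ≡ k))
    × (∀ S → IsREDLD S → k ≤ ∣ S ∣)

{-# OPTIONS --safe #-}
module Submission where

-- Read a subset p of P_n as a 0/1 word. Then p is RED:LD exactly when every 0 lies between
-- two 1s and no 1 lies between two 0s: the first condition is forced because p and p - u
-- must both dominate a vertex outside p, the second because p - v must dominate v; conversely,
-- two outside vertices with a common neighbour in p are at distance two, and the conditions
-- provide a neighbour in p of one of them that is not adjacent to the other.
-- Such words are blocks of at least two 1s separated by single 0s, so a prefix of length m
-- ending in 1 1 carries at least (2m + 2)/3 ones; the word 1 1 0 1 1 0 … 1 1, padded with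
-- at most two further 1s, attains the bound.

open import Defs
open import Data.Bool using (Bool)
open import Data.Bool.Properties using (not-¬)
open import Data.Empty using (⊥; ⊥-elim)
open import Data.Fin using (Fin; zero; suc; toℕ; fromℕ<)
open import Data.Fin.Properties using (toℕ-fromℕ<; toℕ-injective; toℕ<n)
open import Data.Fin.Subset using (Subset; _∈_; _∉_; _-_; ⁅_⁆; ⊤; ∣_∣; inside; outside)
open import Data.Fin.Subset.Properties using (p─q⊆p; x∈p∧x≢y⇒x∈p-y)
open import Data.Nat using (ℕ; zero; suc; _+_; _*_; _≤_; _<_; z≤n; s≤s; s≤s⁻¹; _≟_)
open import Data.Nat.Divisibility using (divides)
open import Data.Nat.DivMod using (_/_; m<n*o⇒m/o<n; +-distrib-/-∣ʳ)
open import Data.Nat.Properties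
open import Data.Nat.Tactic.RingSolver using (solve-∀)
open import Data.Product using (_×_; _,_; Σ-syntax; proj₁; proj₂)
open import Data.Sum using (_⊎_; inj₁; inj₂; [_,_]; swap)
open import Data.Vec using ([]; _∷_; here; there)
open import Function using (_∘_)
open import Function.Bundles using (_⇔_; Equivalence)
open import Function.Properties.Equivalence using () renaming (sym to ⇔-sym)
open import Relation.Binary.PropositionalEquality
  using (_≡_; _≢_; refl; sym; trans; cong; subst; module ≡-Reasoning)
open import Relation.Nullary using (¬_; yes; no)
open import Relation.Nullary.Decidable using (decidable-stable)

private
  variable
    n : ℕ

x∉p-x : ∀ (p : Subset n) x → x ∉ p - x
x∉p-x (inside ∷ p)  zero    ()
x∉p-x (outside ∷ p) zero    ()
x∉p-x (_ ∷ p)       (suc x) (there x∈p-x) = x∉p-x p x x∈p-x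

-- Positions ≥ n read as non-members.
memberAt : Subset n → ℕ → Bool
memberAt []      _       = outside
memberAt (b ∷ p) zero    = b
memberAt (b ∷ p) (suc i) = memberAt p i

infix 4 _∈ₙ_ _∉ₙ_ _∈ₙ?_

_∈ₙ_ : ℕ → Subset n → Set
i ∈ₙ p = memberAt p i ≡ inside

_∉ₙ_ : ℕ → Subset n → Set
i ∉ₙ p = memberAt p i ≡ outside

_∈ₙ?_ : ∀ i (p : Subset n) → i ∈ₙ p ⊎ i ∉ₙ p
i ∈ₙ? p with memberAt p i
... | inside  = inj₁ refl
... | outside = inj₂ refl

∈ₙ⇒< : ∀ {i} (p : Subset n) → i ∈ₙ p → i < n
∈ₙ⇒< []      ()
∈ₙ⇒< {i = zero}  (b ∷ p) _   = s≤s z≤n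
∈ₙ⇒< {i = suc i} (b ∷ p) i∈p = s≤s (∈ₙ⇒< p i∈p)

∈ₙ-vertex : ∀ {i} (p : Subset n) → i ∈ₙ p → Σ[ x ∈ Fin n ] (toℕ x ≡ i × x ∈ p)
∈ₙ-vertex []      ()
∈ₙ-vertex {i = zero}  (inside ∷ p)  _ = zero , refl , here
∈ₙ-vertex {i = zero}  (outside ∷ p) ()
∈ₙ-vertex {i = suc i} (b ∷ p) i∈p with ∈ₙ-vertex p i∈p
... | x , refl , x∈p = suc x , refl , there x∈p

∈⇒∈ₙ : ∀ {x : Fin n} {p} → x ∈ p → toℕ x ∈ₙ p
∈⇒∈ₙ here          = refl
∈⇒∈ₙ (there x∈p)   = ∈⇒∈ₙ x∈p

∈ₙ⇒∈ : ∀ {x : Fin n} p → toℕ x ∈ₙ p → x ∈ p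
∈ₙ⇒∈ {x = zero}  (inside ∷ p)  _   = here
∈ₙ⇒∈ {x = zero}  (outside ∷ p) ()
∈ₙ⇒∈ {x = suc x} (_ ∷ p)       x∈p = there (∈ₙ⇒∈ p x∈p)

∉⇒∉ₙ : ∀ {x : Fin n} p → x ∉ p → toℕ x ∉ₙ p
∉⇒∉ₙ {x = x} p x∉p with toℕ x ∈ₙ? p
... | inj₁ x∈p = ⊥-elim (x∉p (∈ₙ⇒∈ p x∈p))
... | inj₂ x∉p = x∉p

∉ₙ⇒∉ : ∀ {x : Fin n} {p} → toℕ x ∉ₙ p → x ∉ p
∉ₙ⇒∉ x∉p x∈p = not-¬ (∈⇒∈ₙ x∈p) x∉p

vertexAt : ∀ {i} → i < n → Σ[ v ∈ Fin n ] toℕ v ≡ i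
vertexAt i<n = fromℕ< i<n , toℕ-fromℕ< i<n

∈ₙ-remove⁻ : ∀ {i} (p : Subset n) x → i ∈ₙ (p - x) → i ∈ₙ p
∈ₙ-remove⁻ p x i∈p-x with ∈ₙ-vertex (p - x) i∈p-x
... | y , refl , y∈p-x = ∈⇒∈ₙ (p─q⊆p p ⁅ x ⁆ y∈p-x)

∈ₙ-remove⁺ : ∀ {i} (p : Subset n) x → i ∈ₙ p → i ≢ toℕ x → i ∈ₙ (p - x)
∈ₙ-remove⁺ p x i∈p i≢x with ∈ₙ-vertex p i∈p
... | y , refl , y∈p = ∈⇒∈ₙ (x∈p∧x≢y⇒x∈p-y y∈p (i≢x ∘ cong toℕ))

∉ₙ-remove⇒≡ : ∀ {i} (p : Subset n) x → i ∉ₙ (p - x) → i ∈ₙ p → i ≡ toℕ x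
∉ₙ-remove⇒≡ {i = i} p x i∉p-x i∈p =
  decidable-stable (i ≟ toℕ x) (λ i≢x → not-¬ (∈ₙ-remove⁺ p x i∈p i≢x) i∉p-x)

-- Adj (Path n) v w unfolds to Adjacent (toℕ v) (toℕ w).
Adjacent : ℕ → ℕ → Set
Adjacent i j = suc i ≡ j ⊎ suc j ≡ i

distinct-neighbours : ∀ {a b c} → Adjacent c a → Adjacent c b → a ≢ b →
                      (suc a ≡ c × suc c ≡ b) ⊎ (suc b ≡ c × suc c ≡ a)
distinct-neighbours (inj₁ refl)   (inj₁ refl)   a≢b = ⊥-elim (a≢b refl)
distinct-neighbours (inj₁ c+1≡a) (inj₂ b+1≡c) _ = inj₂ (b+1≡c , c+1≡a)
distinct-neighbours (inj₂ a+1≡c) (inj₁ c+1≡b) _ = inj₁ (a+1≡c , c+1≡b)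
distinct-neighbours (inj₂ refl)   (inj₂ refl)   a≢b = ⊥-elim (a≢b refl)

middle-neighbour : ∀ {a b c} → Adjacent a c → Adjacent b c → b ≡ 2 + a → c ≡ suc a
middle-neighbour (inj₁ refl) _         _    = refl
middle-neighbour (inj₂ refl) (inj₁ eq) refl = ⊥-elim (m≢1+n+m _ {3} (sym eq))
middle-neighbour (inj₂ refl) (inj₂ eq) refl = ⊥-elim (m≢1+n+m _ {1} (suc-injective eq))

LeftNeighbourIn : Subset n → ℕ → Set
LeftNeighbourIn p i = Σ[ j ∈ ℕ ] (suc j ≡ i × j ∈ₙ p)

NeighbourIn : Subset n → ℕ → Set
NeighbourIn p i = LeftNeighbourIn p i ⊎ suc i ∈ₙ p

neighbourIn⇒InNbhdS : ∀ {p} (v : Fin n) → NeighbourIn p (toℕ v) →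
                      Σ[ w ∈ Fin n ] InNbhdS (Path n) p v w
neighbourIn⇒InNbhdS {p = p} v (inj₁ (j , j+1≡v , j∈p)) with ∈ₙ-vertex p j∈p
... | w , refl , w∈p = w , w∈p , inj₂ j+1≡v
neighbourIn⇒InNbhdS {p = p} v (inj₂ v+1∈p) with ∈ₙ-vertex p v+1∈p
... | w , w≡v+1 , w∈p = w , w∈p , inj₁ (sym w≡v+1)

InNbhdS⇒neighbourIn : ∀ {p} {v w : Fin n} → InNbhdS (Path n) p v w → NeighbourIn p (toℕ v)
InNbhdS⇒neighbourIn {p = p} (w∈p , inj₁ v+1≡w) = inj₂ (subst (_∈ₙ p) (sym v+1≡w) (∈⇒∈ₙ w∈p))
InNbhdS⇒neighbourIn {w = w} (w∈p , inj₂ w+1≡v) = inj₁ (toℕ w , w+1≡v , ∈⇒∈ₙ w∈p)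

Dominating : Subset n → Set
Dominating {n} p = ∀ i → i < n → i ∉ₙ p → NeighbourIn p i

-- Non-members i and i + 2 share the neighbour i + 1, so one of them needs a second one.
Separating : Subset n → Set
Separating {n} p = ∀ i → 2 + i < n → i ∉ₙ p → suc i ∈ₙ p → 2 + i ∉ₙ p →
                   LeftNeighbourIn p i ⊎ 3 + i ∈ₙ p

separated-at-distance-two : ∀ {p : Subset n} → Separating p → (u v : Fin n) → toℕ v ≡ 2 + toℕ u →
                            u ∉ p → v ∉ p → suc (toℕ u) ∈ₙ p →
                            ¬ (∀ w → InNbhdS (Path n) p u w ⇔ InNbhdS (Path n) p v w)
separated-at-distance-two {n} {p} sep u v v≡u+2 u∉p v∉p u+1∈p same =
  [ left-distinguishes , right-distinguishes ]
    (sep (toℕ u) (subst (_< n) v≡u+2 (toℕ<n v)) (∉⇒∉ₙ p u∉p) u+1∈p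
         (subst (_∉ₙ p) v≡u+2 (∉⇒∉ₙ p v∉p)))
  where
  left-distinguishes : LeftNeighbourIn p (toℕ u) → ⊥
  left-distinguishes (j , j+1≡u , j∈p) with ∈ₙ-vertex p j∈p
  ... | w , refl , w∈p = m≢1+n+m (toℕ w) {1} (trans w≡u+1 (cong suc (sym j+1≡u)))
    where
    w≡u+1 : toℕ w ≡ suc (toℕ u)
    w≡u+1 = middle-neighbour (inj₂ j+1≡u) (proj₂ (Equivalence.to (same w) (w∈p , inj₂ j+1≡u))) v≡u+2

  right-distinguishes : 3 + toℕ u ∈ₙ p → ⊥
  right-distinguishes u+3∈p with ∈ₙ-vertex p u+3∈p
  ... | w , w≡u+3 , w∈p = m≢1+n+m (suc (toℕ u)) {1} (trans (sym w≡u+1) w≡u+3)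
    where
    v~w : Adj (Path n) v w
    v~w = inj₁ (trans (cong suc v≡u+2) (sym w≡u+3))
    w≡u+1 : toℕ w ≡ suc (toℕ u)
    w≡u+1 = middle-neighbour (proj₂ (Equivalence.from (same w) (w∈p , v~w))) v~w v≡u+2

isLD-path : ∀ {p : Subset n} → Dominating p → Separating p → IsLD (Path n) p
isLD-path {n} {p} dom sep = dominates , separates
  where
  dominates : ∀ v → v ∉ p → Σ[ w ∈ Fin n ] InNbhdS (Path n) p v w
  dominates v v∉p = neighbourIn⇒InNbhdS v (dom (toℕ v) (toℕ<n v) (∉⇒∉ₙ p v∉p))

  separates : ∀ u v → u ∉ p → v ∉ p → u ≢ v →
              ¬ (∀ w → InNbhdS (Path n) p v w ⇔ InNbhdS (Path n) p u w)
  separates u v u∉p v∉p u≢v same with dominates v v∉p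
  ... | w , w∈p , v~w with proj₂ (Equivalence.to (same w) (w∈p , v~w))
  ...   | u~w with distinct-neighbours (swap v~w) (swap u~w) (λ v≡u → u≢v (toℕ-injective (sym v≡u)))
  ...     | inj₁ (v+1≡w , w+1≡u) =
    separated-at-distance-two sep v u (trans (sym w+1≡u) (cong suc (sym v+1≡w))) v∉p u∉p
      (subst (_∈ₙ p) (sym v+1≡w) (∈⇒∈ₙ w∈p)) same
  ...     | inj₂ (u+1≡w , w+1≡v) =
    separated-at-distance-two sep u v (trans (sym w+1≡v) (cong suc (sym u+1≡w))) u∉p v∉p
      (subst (_∈ₙ p) (sym u+1≡w) (∈⇒∈ₙ w∈p)) (⇔-sym ∘ same)

GapsFlanked : Subset n → Set
GapsFlanked {n} p = ∀ i → i < n → i ∉ₙ p → LeftNeighbourIn p i × suc i ∈ₙ p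

NoIsolatedMember : Subset n → Set
NoIsolatedMember p = ∀ i → i ∈ₙ p → NeighbourIn p i

flanked : ∀ {p} {u v w : Fin n} → InNbhdS (Path n) p v u → InNbhdS (Path n) p v w →
          toℕ u ≢ toℕ w →
          LeftNeighbourIn p (toℕ v) × suc (toℕ v) ∈ₙ p
flanked {p = p} {u} {v} {w} (u∈p , v~u) (w∈p , v~w) u≢w with distinct-neighbours v~u v~w u≢w
... | inj₁ (u+1≡v , v+1≡w) = (toℕ u , u+1≡v , ∈⇒∈ₙ u∈p) , subst (_∈ₙ p) (sym v+1≡w) (∈⇒∈ₙ w∈p)
... | inj₂ (w+1≡v , v+1≡u) = (toℕ w , w+1≡v , ∈⇒∈ₙ w∈p) , subst (_∈ₙ p) (sym v+1≡u) (∈⇒∈ₙ u∈p)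

redLD⇒gapsFlanked : ∀ {p : Subset n} → IsREDLD (Path n) p → GapsFlanked p
redLD⇒gapsFlanked {p = p} ((dom , _) , red) i i<n i∉p with vertexAt i<n
... | v , refl with dom v (∉ₙ⇒∉ i∉p)
...   | u , u∈p , v~u with proj₁ (red u u∈p) v (∉ₙ⇒∉ i∉p ∘ p─q⊆p p ⁅ u ⁆)
...     | w , w∈p-u , v~w =
  flanked (u∈p , v~u) (p─q⊆p p ⁅ u ⁆ w∈p-u , v~w)
          (λ u≡w → x∉p-x p u (subst (_∈ p - u) (sym (toℕ-injective u≡w)) w∈p-u))

redLD⇒noIsolatedMember : ∀ {p : Subset n} → IsREDLD (Path n) p → NoIsolatedMember p
redLD⇒noIsolatedMember {p = p} (_ , red) i i∈p with ∈ₙ-vertex p i∈p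
... | v , refl , v∈p with proj₁ (red v v∈p) v (x∉p-x p v)
...   | w , w∈p-v , v~w = InNbhdS⇒neighbourIn (p─q⊆p p ⁅ v ⁆ w∈p-v , v~w)

no-member-between-gaps : ∀ {i} (p : Subset n) → NoIsolatedMember p →
                         i ∉ₙ p → suc i ∈ₙ p → 2 + i ∉ₙ p → ⊥
no-member-between-gaps p iso i∉p i+1∈p i+2∉p with iso _ i+1∈p
... | inj₁ (_ , refl , i∈p) = not-¬ i∈p i∉p
... | inj₂ i+2∈p           = not-¬ i+2∈p i+2∉p

dominating-remove : ∀ {p : Subset n} → GapsFlanked p → NoIsolatedMember p → ∀ x → Dominating (p - x)
dominating-remove {p = p} flank iso x i i<n i∉p-x with i ∈ₙ? p
... | inj₁ i∈p with ∉ₙ-remove⇒≡ p x i∉p-x i∈p | iso i i∈p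
...   | i≡x | inj₁ (j , refl , j∈p) =
  inj₁ (j , refl , ∈ₙ-remove⁺ p x j∈p (λ j≡x → 1+n≢n (sym (trans j≡x (sym i≡x)))))
...   | i≡x | inj₂ i+1∈p = inj₂ (∈ₙ-remove⁺ p x i+1∈p (λ i+1≡x → 1+n≢n (trans i+1≡x (sym i≡x))))
dominating-remove {p = p} flank iso x i i<n i∉p-x | inj₂ i∉p with flank i i<n i∉p
... | (j , refl , j∈p) , i+1∈p with suc i ≟ toℕ x
...   | no i+1≢x  = inj₂ (∈ₙ-remove⁺ p x i+1∈p i+1≢x)
...   | yes i+1≡x = inj₁ (j , refl , ∈ₙ-remove⁺ p x j∈p (λ j≡x → m≢1+n+m j {1} (trans j≡x (sym i+1≡x))))

separating-remove : ∀ {p : Subset n} → GapsFlanked p → NoIsolatedMember p → ∀ x → Separating (p - x)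
separating-remove {p = p} flank iso x i i+2<n i∉p-x i+1∈p-x i+2∉p-x with i ∈ₙ? p | 2 + i ∈ₙ? p
... | inj₂ i∉p | inj₂ i+2∉p = ⊥-elim (no-member-between-gaps p iso i∉p (∈ₙ-remove⁻ p x i+1∈p-x) i+2∉p)
... | inj₁ i∈p | inj₁ i+2∈p =
  ⊥-elim (m≢1+n+m i {1} (trans (∉ₙ-remove⇒≡ p x i∉p-x i∈p) (sym (∉ₙ-remove⇒≡ p x i+2∉p-x i+2∈p))))
... | inj₂ i∉p | inj₁ i+2∈p with flank i (m+n≤o⇒n≤o 2 i+2<n) i∉p
...   | (j , refl , j∈p) , _ = inj₁ (j , refl , ∈ₙ-remove⁺ p x j∈p j≢x)
  where
  j≢x : j ≢ toℕ x
  j≢x j≡x = m≢1+n+m j {2} (trans j≡x (sym (∉ₙ-remove⇒≡ p x i+2∉p-x i+2∈p)))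
separating-remove {p = p} flank iso x i i+2<n i∉p-x i+1∈p-x i+2∉p-x | inj₁ i∈p | inj₂ i+2∉p
  with flank (2 + i) i+2<n i+2∉p
... | _ , i+3∈p = inj₂ (∈ₙ-remove⁺ p x i+3∈p i+3≢x)
  where
  i+3≢x : 3 + i ≢ toℕ x
  i+3≢x i+3≡x = m≢1+n+m i {2} (trans (∉ₙ-remove⇒≡ p x i∉p-x i∈p) (sym i+3≡x))

isREDLD-path : ∀ {p : Subset n} → GapsFlanked p → NoIsolatedMember p → IsREDLD (Path n) p
isREDLD-path {p = p} flank iso =
  isLD-path (λ i i<n i∉p → inj₁ (proj₁ (flank i i<n i∉p)))
            (λ i _ i∉p i+1∈p i+2∉p → ⊥-elim (no-member-between-gaps p iso i∉p i+1∈p i+2∉p)) ,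
  λ x _ → isLD-path (dominating-remove {p = p} flank iso x) (separating-remove {p = p} flank iso x)

countBelow : Subset n → ℕ → ℕ
countBelow _             zero    = 0
countBelow []            (suc k) = 0
countBelow (inside ∷ p)  (suc k) = suc (countBelow p k)
countBelow (outside ∷ p) (suc k) = countBelow p k

countBelow-∈ : ∀ (p : Subset n) k → k ∈ₙ p → countBelow p (suc k) ≡ suc (countBelow p k)
countBelow-∈ []            _       ()
countBelow-∈ (inside ∷ p)  zero    _   = refl
countBelow-∈ (outside ∷ p) zero    ()
countBelow-∈ (inside ∷ p)  (suc k) k∈p = cong suc (countBelow-∈ p k k∈p)
countBelow-∈ (outside ∷ p) (suc k) k∈p = countBelow-∈ p k k∈p

countBelow-∉ : ∀ (p : Subset n) k → k ∉ₙ p → countBelow p (suc k) ≡ countBelow p k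
countBelow-∉ []            zero    _   = refl
countBelow-∉ []            (suc k) _   = refl
countBelow-∉ (inside ∷ p)  zero    ()
countBelow-∉ (outside ∷ p) zero    _   = refl
countBelow-∉ (inside ∷ p)  (suc k) k∉p = cong suc (countBelow-∉ p k k∉p)
countBelow-∉ (outside ∷ p) (suc k) k∉p = countBelow-∉ p k k∉p

countBelow-all : ∀ (p : Subset n) → countBelow p n ≡ ∣ p ∣
countBelow-all []            = refl
countBelow-all (inside ∷ p)  = cong suc (countBelow-all p)
countBelow-all (outside ∷ p) = countBelow-all p

prefix-bound-step : ∀ {m c} d e → 2 * m + 2 ≤ 3 * c → 2 * d ≤ 3 * e → 2 * (d + m) + 2 ≤ 3 * (e + c)
prefix-bound-step {m} {c} d e m≤c d≤e = begin
  2 * (d + m) + 2     ≡⟨ cong (_+ 2) (*-distribˡ-+ 2 d m) ⟩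
  2 * d + 2 * m + 2   ≡⟨ +-assoc (2 * d) (2 * m) 2 ⟩
  2 * d + (2 * m + 2) ≤⟨ +-mono-≤ d≤e m≤c ⟩
  3 * e + 3 * c       ≡⟨ *-distribˡ-+ 3 e c ⟨
  3 * (e + c)         ∎
  where open ≤-Reasoning

-- Before two consecutive 1s there is either another 1 or the pattern 1 1 0.
prefix-bound : ∀ (p : Subset n) → GapsFlanked p → NoIsolatedMember p →
               ∀ k → k ∈ₙ p → suc k ∈ₙ p → 2 * (2 + k) + 2 ≤ 3 * countBelow p (2 + k)
prefix-bound p _ _ zero 0∈p 1∈p
  rewrite countBelow-∈ p 1 1∈p | countBelow-∈ p 0 0∈p = ≤-refl
prefix-bound p flank iso (suc k) k+1∈p k+2∈p with k ∈ₙ? p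
... | inj₁ k∈p
  rewrite countBelow-∈ p (2 + k) k+2∈p =
  prefix-bound-step {m = 2 + k} 1 1 (prefix-bound p flank iso k k∈p k+1∈p) (n≤1+n 2)
... | inj₂ k∉p with flank k (<⇒≤ (∈ₙ⇒< p k+1∈p)) k∉p
...   | (j , refl , j∈p) , _ with iso j j∈p
...     | inj₂ k∈p = ⊥-elim (not-¬ k∈p k∉p)
...     | inj₁ (i , refl , i∈p)
  rewrite countBelow-∈ p (4 + i) k+2∈p | countBelow-∈ p (3 + i) k+1∈p | countBelow-∉ p (2 + i) k∉p =
  prefix-bound-step {m = 2 + i} 3 2 (prefix-bound p flank iso i i∈p j∈p) ≤-refl

last-two-members : ∀ {k} (p : Subset (2 + k)) → GapsFlanked p → NoIsolatedMember p → k ∈ₙ p × suc k ∈ₙ p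
last-two-members {k} p flank iso with suc k ∈ₙ? p
... | inj₂ k+1∉p = ⊥-elim (<-irrefl refl (∈ₙ⇒< p (proj₂ (flank (suc k) ≤-refl k+1∉p))))
... | inj₁ k+1∈p with iso (suc k) k+1∈p
...   | inj₁ (_ , refl , k∈p) = k∈p , k+1∈p
...   | inj₂ k+2∈p            = ⊥-elim (<-irrefl refl (∈ₙ⇒< p k+2∈p))

ceiling-bound : ∀ {m c} → 2 * m + 2 ≤ 3 * c → (2 * m + 2 + 2) / 3 ≤ c
ceiling-bound {m} {c} m≤c = s≤s⁻¹ (m<n*o⇒m/o<n (begin-strict
  2 * m + 2 + 2   ≡⟨ +-comm (2 * m + 2) 2 ⟩
  2 + (2 * m + 2) <⟨ n<1+n _ ⟩
  3 + (2 * m + 2) ≤⟨ +-monoʳ-≤ 3 m≤c ⟩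
  3 + 3 * c       ≡⟨ *-suc 3 c ⟨
  3 * suc c       ≡⟨ *-comm 3 (suc c) ⟩
  suc c * 3       ∎))
  where open ≤-Reasoning

redLD-lower-bound : ∀ k (p : Subset (2 + k)) → IsREDLD (Path (2 + k)) p →
                    (2 * (2 + k) + 2 + 2) / 3 ≤ ∣ p ∣
redLD-lower-bound k p redLD = ceiling-bound {m = 2 + k} (begin
  2 * (2 + k) + 2          ≤⟨ prefix-bound p flank iso k (proj₁ last-two) (proj₂ last-two) ⟩
  3 * countBelow p (2 + k) ≡⟨ cong (3 *_) (countBelow-all p) ⟩
  3 * ∣ p ∣                 ∎)
  where
  open ≤-Reasoning
  flank : GapsFlanked p
  flank = redLD⇒gapsFlanked redLD
  iso : NoIsolatedMember p
  iso = redLD⇒noIsolatedMember redLD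
  last-two : k ∈ₙ p × suc k ∈ₙ p
  last-two = last-two-members p flank iso

<⇒∈ₙ⊤ : ∀ {i} → i < n → i ∈ₙ ⊤ {n}
<⇒∈ₙ⊤ {i = zero}  (s≤s _)   = refl
<⇒∈ₙ⊤ {i = suc i} (s≤s i<n) = <⇒∈ₙ⊤ i<n

⊤-gapsFlanked : GapsFlanked (⊤ {n})
⊤-gapsFlanked i i<n i∉⊤ = ⊥-elim (not-¬ (<⇒∈ₙ⊤ i<n) i∉⊤)

⊤-noIsolatedMember : NoIsolatedMember (⊤ {2 + n})
⊤-noIsolatedMember     zero    _     = inj₂ refl
⊤-noIsolatedMember {n} (suc i) i+1∈⊤ =
  inj₁ (i , refl , <⇒∈ₙ⊤ (<-trans (n<1+n i) (∈ₙ⇒< (⊤ {2 + n}) i+1∈⊤)))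

gapsFlanked-110∷ : ∀ {p : Subset n} → 0 ∈ₙ p → GapsFlanked p →
                   GapsFlanked (inside ∷ inside ∷ outside ∷ p)
gapsFlanked-110∷ _   _     0 _ ()
gapsFlanked-110∷ _   _     1 _ ()
gapsFlanked-110∷ 0∈p _     2 _ _ = (1 , refl , refl) , 0∈p
gapsFlanked-110∷ _   flank (suc (suc (suc i))) (s≤s (s≤s (s≤s i<n))) i∉p with flank i i<n i∉p
... | (j , refl , j∈p) , i+1∈p = (3 + j , refl , j∈p) , i+1∈p

noIsolatedMember-110∷ : ∀ {p : Subset n} → NoIsolatedMember p →
                        NoIsolatedMember (inside ∷ inside ∷ outside ∷ p)
noIsolatedMember-110∷ _   0 _ = inj₂ refl
noIsolatedMember-110∷ _   1 _ = inj₁ (0 , refl , refl)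
noIsolatedMember-110∷ _   2 ()
noIsolatedMember-110∷ iso (suc (suc (suc i))) i∈p with iso i i∈p
... | inj₁ (j , refl , j∈p) = inj₁ (3 + j , refl , j∈p)
... | inj₂ i+1∈p            = inj₂ i+1∈p

optimal : ∀ m → Subset (2 + m)
optimal 0                   = ⊤
optimal 1                   = ⊤
optimal 2                   = ⊤
optimal (suc (suc (suc m))) = inside ∷ inside ∷ outside ∷ optimal m

0∈ₙoptimal : ∀ m → 0 ∈ₙ optimal m
0∈ₙoptimal 0                   = refl
0∈ₙoptimal 1                   = refl
0∈ₙoptimal 2                   = refl
0∈ₙoptimal (suc (suc (suc m))) = refl

optimal-gapsFlanked : ∀ m → GapsFlanked (optimal m)
optimal-gapsFlanked 0                   = ⊤-gapsFlanked
optimal-gapsFlanked 1                   = ⊤-gapsFlanked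
optimal-gapsFlanked 2                   = ⊤-gapsFlanked
optimal-gapsFlanked (suc (suc (suc m))) = gapsFlanked-110∷ (0∈ₙoptimal m) (optimal-gapsFlanked m)

optimal-noIsolatedMember : ∀ m → NoIsolatedMember (optimal m)
optimal-noIsolatedMember 0                   = ⊤-noIsolatedMember
optimal-noIsolatedMember 1                   = ⊤-noIsolatedMember
optimal-noIsolatedMember 2                   = ⊤-noIsolatedMember
optimal-noIsolatedMember (suc (suc (suc m))) = noIsolatedMember-110∷ (optimal-noIsolatedMember m)

ceiling-step : ∀ m → (2 * (3 + m) + 2 + 2) / 3 ≡ 2 + (2 * m + 2 + 2) / 3
ceiling-step m = begin
  (2 * (3 + m) + 2 + 2) / 3 ≡⟨ cong (_/ 3) (shift m) ⟩
  (2 * m + 2 + 2 + 6) / 3   ≡⟨ +-distrib-/-∣ʳ (2 * m + 2 + 2) (divides 2 refl) ⟩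
  (2 * m + 2 + 2) / 3 + 2   ≡⟨ +-comm _ 2 ⟩
  2 + (2 * m + 2 + 2) / 3   ∎
  where
  open ≡-Reasoning
  shift : ∀ m → 2 * (3 + m) + 2 + 2 ≡ 2 * m + 2 + 2 + 6
  shift = solve-∀

∣optimal∣ : ∀ m → ∣ optimal m ∣ ≡ (2 * (2 + m) + 2 + 2) / 3
∣optimal∣ 0                   = refl
∣optimal∣ 1                   = refl
∣optimal∣ 2                   = refl
∣optimal∣ (suc (suc (suc m))) = trans (cong (2 +_) (∣optimal∣ m)) (sym (ceiling-step (2 + m)))

theorem13 : (n : ℕ) → 2 ≤ n → REDLDNumber (Path n) ((2 * n + 2 + 2) / 3)
theorem13 (suc zero)    (s≤s ())
theorem13 (suc (suc k)) _ =
  (optimal k , isREDLD-path (optimal-gapsFlanked k) (optimal-noIsolatedMember k) , ∣optimal∣ k) ,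
  redLD-lower-bound k
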